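{- For every permutation $\pi$ of rank $n$, \[\operatorname{ninvsum}(\pi^{\mathrm{i}})=\operatorname{ninvsum}(\pi),\] equivalently \[\sum_{(a,b)\in\mathrm{NINV}(\pi)}\bigl(\pi(b)-\pi(a)\bigr)=\sum_{(a,b)\in\mathrm{NINV}(\pi)}(b-a).\] Similarly, $\operatorname{invsum}(\pi^{\mathrm{i}})=\operatorname{invsum}(\pi)$.
   Context: For a permutation $\pi$ of rank $n$ (a bijection of $\{1,\dots,n\}$), an inversion is a pair $(a,b)$ with $1\le a<b\le n$ and $\pi(a)>\pi(b)$; a non-inversion is a pair $(a,b)$ with $1\le a<b\le n$ and $\pi(a)<\pi(b)$. $\mathrm{INV}(\pi)$ and $\mathrm{NINV}(\pi)$ denote the sets of inversions and non-inversions. The inversion sum is $\operatorname{invsum}(\pi)=\sum_{(a,b)\in\mathrm{INV}(\pi)}(b-a)$ and the non-inversion sum is $\operatorname{ninvsum}(\pi)=\sum_{(a,b)\in\mathrm{NINV}(\pi)}(b-a)$. $\pi^{\mathrm{i}}$ is the inverse permutation of $\pi$. -}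

module Defs where

open import Data.Nat using (ℕ; _∸_; _<ᵇ_)
open import Data.Bool using (Bool; if_then_else_)
open import Data.Fin using (Fin; toℕ)
open import Data.Nat.ListAction using (sum)
open import Data.List using (List; map; concatMap; allFin)
open import Data.Fin.Permutation using (Permutation′; _⟨$⟩ʳ_)

-- Positions are Fin n = {0,…,n-1} (shift of {1,…,n}; differences b - a are unaffected).

pairSum : ∀ {n} → (Fin n → Fin n → ℕ) → ℕ
pairSum {n} f = sum (concatMap (λ a → map (λ b → f a b) (allFin n)) (allFin n))

invsum : ∀ {n} → Permutation′ n → ℕ
invsum π = pairSum (λ a b →
  if toℕ a <ᵇ toℕ b then
    (if toℕ (π ⟨$⟩ʳ b) <ᵇ toℕ (π ⟨$⟩ʳ a) then toℕ b ∸ toℕ a else 0)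
  else 0)

ninvsum : ∀ {n} → Permutation′ n → ℕ
ninvsum π = pairSum (λ a b →
  if toℕ a <ᵇ toℕ b then
    (if toℕ (π ⟨$⟩ʳ a) <ᵇ toℕ (π ⟨$⟩ʳ b) then toℕ b ∸ toℕ a else 0)
  else 0)

ninvValueSum : ∀ {n} → Permutation′ n → ℕ
ninvValueSum π = pairSum (λ a b →
  if toℕ a <ᵇ toℕ b then
    (if toℕ (π ⟨$⟩ʳ a) <ᵇ toℕ (π ⟨$⟩ʳ b) then toℕ (π ⟨$⟩ʳ b) ∸ toℕ (π ⟨$⟩ʳ a) else 0)
  else 0)

-- Write x for the position and u = π(x) for the value. Each of the four sums is the total positive
-- (rise) or negative (fall) gap of one of x, u over the pairs increasing in the other, and the theorem
-- is the symmetry of rise and fall in x and u. Two linear relations determine them. Rise plus fall of x along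
-- u is the sum of |Δx| over all unordered pairs, the same for any two rank functions. Rise minus fall
-- of x along u is Σ over u-increasing pairs of (x b − x a); counting the ranks below and above each u a
-- turns it into Σ_a x_a (2 u_a − n + 1), which is symmetric in x and u because Σ x = Σ u.

module Submission where

open import Defs
open import Data.Nat using (ℕ; zero; suc; _+_; _*_; _∸_; _<ᵇ_; _≤_; _<_; ∣_-_∣; z≤n; s≤s)
open import Data.Nat.Properties
  using (+-identityʳ; +-comm; *-comm; +-cancelʳ-≡; +-cancelˡ-≡; +-suc; *-cancelˡ-≡; *-identityˡ; *-distribʳ-+; <⇒≤; ∣-∣-comm; ∣n-n∣≡0;
         +-commutativeSemigroup; +-*-semiring)
open import Data.Product using (_×_; _,_; proj₁; proj₂)
open import Data.Bool using (Bool; true; false; if_then_else_)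
open import Data.Bool.Properties using (if-swap-then)
open import Data.Fin using (Fin; toℕ)
import Data.Fin as Fin
open import Data.Fin.Properties using (toℕ-injective; toℕ<n)
open import Data.Fin.Permutation using (Permutation′; flip; id; _⟨$⟩ʳ_; _⟨$⟩ˡ_; inverseˡ)
open import Data.List using (List; []; _∷_; map; concatMap; allFin; tabulate)
open import Data.List.Properties using (map-tabulate)
import Data.Nat.ListAction as List
open import Data.Nat.ListAction.Properties using (sum-++)
open import Function using (_∘_)
open import Relation.Binary.PropositionalEquality using (_≡_; refl; sym; trans; cong; cong₂; module ≡-Reasoning)
open import Algebra.Properties.CommutativeSemigroup +-commutativeSemigroup using (interchange)
open import Algebra.Properties.Semiring.Sum +-*-semiring
  using (sum; sum-syntax; sum-cong-≗; ∑-comm; ∑-distrib-+; sum-permute; *-distribʳ-sum)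

open ≡-Reasoning

private
  variable
    n : ℕ

m+m≡n+n⇒m≡n : ∀ {m n} → m + m ≡ n + n → m ≡ n
m+m≡n+n⇒m≡n {m} {n} eq = *-cancelˡ-≡ m n 2 (begin
  2 * m   ≡⟨ cong (m +_) (+-identityʳ m) ⟩
  m + m   ≡⟨ eq ⟩
  n + n   ≡⟨ cong (n +_) (+-identityʳ n) ⟨
  2 * n   ∎)

+-cancel-crossed : ∀ {m n m′ n′} → m + n ≡ m′ + n′ → m + n′ ≡ m′ + n → m ≡ m′ × n ≡ n′
+-cancel-crossed {m} {n} {m′} {n′} sum≡ diff≡ = m≡m′ , +-cancelˡ-≡ m n n′ (trans sum≡ (cong (_+ n′) (sym m≡m′)))
  where
  m≡m′ : m ≡ m′
  m≡m′ = m+m≡n+n⇒m≡n (+-cancelʳ-≡ (n + n′) _ _ (begin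
    (m + m) + (n + n′)     ≡⟨ interchange m m n n′ ⟩
    (m + n) + (m + n′)     ≡⟨ cong₂ _+_ sum≡ diff≡ ⟩
    (m′ + n′) + (m′ + n)   ≡⟨ interchange m′ n′ m′ n ⟩
    (m′ + m′) + (n′ + n)   ≡⟨ cong ((m′ + m′) +_) (+-comm n′ n) ⟩
    (m′ + m′) + (n + n′)   ∎))

[n∸m]+[m∸n]≡∣m-n∣ : ∀ m n → (n ∸ m) + (m ∸ n) ≡ ∣ m - n ∣
[n∸m]+[m∸n]≡∣m-n∣ zero    zero    = refl
[n∸m]+[m∸n]≡∣m-n∣ zero    (suc n) = +-identityʳ (suc n)
[n∸m]+[m∸n]≡∣m-n∣ (suc m) zero    = refl
[n∸m]+[m∸n]≡∣m-n∣ (suc m) (suc n) = [n∸m]+[m∸n]≡∣m-n∣ m n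

[n∸m]+m≡[m∸n]+n : ∀ m n → (n ∸ m) + m ≡ (m ∸ n) + n
[n∸m]+m≡[m∸n]+n zero    zero    = refl
[n∸m]+m≡[m∸n]+n zero    (suc n) = +-comm (suc n) 0
[n∸m]+m≡[m∸n]+n (suc m) zero    = sym (+-identityʳ (suc m))
[n∸m]+m≡[m∸n]+n (suc m) (suc n) = trans (+-suc (n ∸ m) m) (trans (cong suc ([n∸m]+m≡[m∸n]+n m n)) (sym (+-suc (m ∸ n) n)))

if<ᵇ-∸ : ∀ m n → (if m <ᵇ n then n ∸ m else 0) ≡ n ∸ m
if<ᵇ-∸ zero    zero    = refl
if<ᵇ-∸ zero    (suc n) = refl
if<ᵇ-∸ (suc m) zero    = refl
if<ᵇ-∸ (suc m) (suc n) = if<ᵇ-∸ m n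

if<ᵇ+if>ᵇ : ∀ x y w → (x ≡ y → w ≡ 0) → (if x <ᵇ y then w else 0) + (if y <ᵇ x then w else 0) ≡ w
if<ᵇ+if>ᵇ zero    zero    w x≡y⇒w≡0 = sym (x≡y⇒w≡0 refl)
if<ᵇ+if>ᵇ zero    (suc y) w _       = +-identityʳ w
if<ᵇ+if>ᵇ (suc x) zero    w _       = refl
if<ᵇ+if>ᵇ (suc x) (suc y) w x≡y⇒w≡0 = if<ᵇ+if>ᵇ x y w (x≡y⇒w≡0 ∘ cong suc)

if-distrib-+ : ∀ c x y → (if c then x + y else 0) ≡ (if c then x else 0) + (if c then y else 0)
if-distrib-+ false x y = refl
if-distrib-+ true  x y = refl

if-then-1-* : ∀ c w → (if c then w else 0) ≡ (if c then 1 else 0) * w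
if-then-1-* false w = refl
if-then-1-* true  w = sym (*-identityˡ w)

∑² : (Fin n → Fin n → ℕ) → ℕ
∑² {n} h = ∑[ a < n ] ∑[ b < n ] h a b

∑²-cong : {h k : Fin n → Fin n → ℕ} → (∀ a b → h a b ≡ k a b) → ∑² h ≡ ∑² k
∑²-cong h≡k = sum-cong-≗ (λ a → sum-cong-≗ (h≡k a))

∑²-comm : (h : Fin n → Fin n → ℕ) → ∑² h ≡ ∑² (λ a b → h b a)
∑²-comm = ∑-comm

∑²-distrib-+ : (h k : Fin n → Fin n → ℕ) → ∑² (λ a b → h a b + k a b) ≡ ∑² h + ∑² k
∑²-distrib-+ h k = trans (sum-cong-≗ (λ a → ∑-distrib-+ (h a) (k a))) (∑-distrib-+ (λ a → sum (h a)) (λ a → sum (k a)))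

∑²-permute : (σ : Permutation′ n) (h : Fin n → Fin n → ℕ) → ∑² h ≡ ∑² (λ a b → h (σ ⟨$⟩ʳ a) (σ ⟨$⟩ʳ b))
∑²-permute σ h = trans (sum-cong-≗ (λ a → sum-permute (h a) σ)) (sum-permute _ σ)

sum-tabulate : (f : Fin n → ℕ) → List.sum (tabulate f) ≡ sum f
sum-tabulate {zero}  f = refl
sum-tabulate {suc n} f = cong (f Fin.zero +_) (sum-tabulate (f ∘ Fin.suc))

sum-map-allFin : (f : Fin n → ℕ) → List.sum (map f (allFin n)) ≡ sum f
sum-map-allFin f = trans (cong List.sum (map-tabulate (λ a → a) f)) (sum-tabulate f)

sum-concatMap : ∀ {A : Set} (g : A → List ℕ) (xs : List A) → List.sum (concatMap g xs) ≡ List.sum (map (List.sum ∘ g) xs)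
sum-concatMap g []       = refl
sum-concatMap g (x ∷ xs) = trans (sum-++ (g x) (concatMap g xs)) (cong (List.sum (g x) +_) (sum-concatMap g xs))

pairSum≡∑² : (h : Fin n → Fin n → ℕ) → pairSum h ≡ ∑² h
pairSum≡∑² {n} h = begin
  pairSum h                                        ≡⟨ sum-concatMap _ (allFin n) ⟩
  List.sum (map (List.sum ∘ row) (allFin n))       ≡⟨ sum-map-allFin (List.sum ∘ row) ⟩
  ∑[ a < n ] List.sum (row a)                      ≡⟨ sum-cong-≗ (λ a → sum-map-allFin (h a)) ⟩
  ∑² h                                             ∎
  where
  row : Fin n → List ℕ
  row a = map (h a) (allFin n)

count : (Fin n → Bool) → ℕ
count {n} p = ∑[ a < n ] (if p a then 1 else 0)

sum-if : (p : Fin n → Bool) (w : ℕ) → ∑[ a < n ] (if p a then w else 0) ≡ count p * w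
sum-if p w = trans (sum-cong-≗ (λ a → if-then-1-* (p a) w)) (sym (*-distribʳ-sum w (λ a → if p a then 1 else 0)))

∑↑ : (Fin n → ℕ) → (Fin n → Fin n → ℕ) → ℕ
∑↑ g h = ∑² (λ a b → if g a <ᵇ g b then h a b else 0)

rise fall : (Fin n → ℕ) → (Fin n → ℕ) → ℕ
rise g f = ∑↑ g (λ a b → f b ∸ f a)
fall g f = ∑↑ g (λ a b → f a ∸ f b)

∑↑-distrib-+ : (g : Fin n → ℕ) (h k : Fin n → Fin n → ℕ) → ∑↑ g (λ a b → h a b + k a b) ≡ ∑↑ g h + ∑↑ g k
∑↑-distrib-+ {n} g h k = trans (∑²-cong (λ a b → if-distrib-+ (g a <ᵇ g b) (h a b) (k a b))) (∑²-distrib-+ {n} _ _)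

∑↑-double : (g : Fin n → ℕ) (h : Fin n → Fin n → ℕ) → (∀ a b → h a b ≡ h b a) → (∀ a b → g a ≡ g b → h a b ≡ 0) →
            ∑↑ g h + ∑↑ g h ≡ ∑² h
∑↑-double {n} g h h-sym h-tie = begin
  ∑↑ g h + ∑↑ g h                                        ≡⟨ cong (∑↑ g h +_) (∑²-comm {n} _) ⟩
  ∑↑ g h + ∑² (λ a b → if g b <ᵇ g a then h b a else 0)  ≡⟨ ∑²-distrib-+ {n} _ _ ⟨
  ∑² (λ a b → (if g a <ᵇ g b then h a b else 0) + (if g b <ᵇ g a then h b a else 0))
                                                         ≡⟨ ∑²-cong split ⟩
  ∑² h                                                   ∎
  where
  split : ∀ a b → (if g a <ᵇ g b then h a b else 0) + (if g b <ᵇ g a then h b a else 0) ≡ h a b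
  split a b = trans (cong (λ w → (if g a <ᵇ g b then h a b else 0) + (if g b <ᵇ g a then w else 0)) (h-sym b a))
                    (if<ᵇ+if>ᵇ (g a) (g b) (h a b) (h-tie a b))

-- Truncated subtraction: f b ∸ f a vanishes unless f a < f b.
∑²-gap≡∑↑ : (f : Fin n → ℕ) (c : Fin n → Fin n → Bool) →
            ∑² (λ a b → if c a b then f b ∸ f a else 0) ≡ ∑↑ f (λ a b → if c a b then f b ∸ f a else 0)
∑²-gap≡∑↑ f c = ∑²-cong (λ a b → trans (cong (λ w → if c a b then w else 0) (sym (if<ᵇ-∸ (f a) (f b))))
                                       (if-swap-then (c a b) (f a <ᵇ f b)))

rise≡∑↑-concordant : (g f : Fin n → ℕ) → rise g f ≡ ∑↑ f (λ a b → if g a <ᵇ g b then f b ∸ f a else 0)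
rise≡∑↑-concordant g f = ∑²-gap≡∑↑ f (λ a b → g a <ᵇ g b)

fall≡∑↑-discordant : (g f : Fin n → ℕ) → fall g f ≡ ∑↑ f (λ a b → if g b <ᵇ g a then f b ∸ f a else 0)
fall≡∑↑-discordant {n} g f = trans (∑²-comm {n} _) (∑²-gap≡∑↑ f (λ a b → g b <ᵇ g a))

rise+fall : (g f : Fin n → ℕ) → rise g f + fall g f ≡ ∑↑ g (λ a b → ∣ f a - f b ∣)
rise+fall g f = trans (sym (∑↑-distrib-+ g _ _))
                      (∑²-cong (λ a b → cong (λ w → if g a <ᵇ g b then w else 0) ([n∸m]+[m∸n]≡∣m-n∣ (f a) (f b))))

rise-fall-balance : (g f : Fin n → ℕ) → rise g f + ∑↑ g (λ a b → f a) ≡ fall g f + ∑↑ g (λ a b → f b)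
rise-fall-balance g f = begin
  rise g f + ∑↑ g (λ a b → f a)         ≡⟨ ∑↑-distrib-+ g _ _ ⟨
  ∑↑ g (λ a b → (f b ∸ f a) + f a)      ≡⟨ ∑²-cong (λ a b → cong (λ w → if g a <ᵇ g b then w else 0) ([n∸m]+m≡[m∸n]+n (f a) (f b))) ⟩
  ∑↑ g (λ a b → (f a ∸ f b) + f b)      ≡⟨ ∑↑-distrib-+ g _ _ ⟩
  fall g f + ∑↑ g (λ a b → f b)         ∎

rank : Permutation′ n → Fin n → ℕ
rank σ a = toℕ (σ ⟨$⟩ʳ a)

rank-injective : (σ : Permutation′ n) {a b : Fin n} → rank σ a ≡ rank σ b → a ≡ b
rank-injective σ {a} {b} eq = begin
  a                      ≡⟨ inverseˡ σ ⟨
  σ ⟨$⟩ˡ (σ ⟨$⟩ʳ a)      ≡⟨ cong (σ ⟨$⟩ˡ_) (toℕ-injective eq) ⟩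
  σ ⟨$⟩ˡ (σ ⟨$⟩ʳ b)      ≡⟨ inverseˡ σ ⟩
  b                      ∎

sum-rank : (σ : Permutation′ n) (φ : ℕ → ℕ) → ∑[ a < n ] φ (rank σ a) ≡ ∑[ a < n ] φ (toℕ a)
sum-rank σ φ = sym (sum-permute (φ ∘ toℕ) σ)

∑²-rank : (σ : Permutation′ n) (φ : ℕ → ℕ → ℕ) → ∑² (λ a b → φ (rank σ a) (rank σ b)) ≡ ∑² {n} (λ a b → φ (toℕ a) (toℕ b))
∑²-rank σ φ = sym (∑²-permute σ (λ a b → φ (toℕ a) (toℕ b)))

∑↑-flip : (σ : Permutation′ n) (h : Fin n → Fin n → ℕ) →
          ∑↑ (rank (flip σ)) h ≡ ∑↑ toℕ (λ a b → h (σ ⟨$⟩ʳ a) (σ ⟨$⟩ʳ b))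
∑↑-flip σ h = trans (∑²-permute σ _) (∑²-cong (λ a b →
  cong₂ (λ i j → if toℕ i <ᵇ toℕ j then h (σ ⟨$⟩ʳ a) (σ ⟨$⟩ʳ b) else 0) (inverseˡ σ) (inverseˡ σ)))

∑-1 : ∀ n → ∑[ a < n ] 1 ≡ n
∑-1 zero    = refl
∑-1 (suc n) = cong suc (∑-1 n)

count-below-toℕ : ∀ v → v ≤ n → count {n} (λ a → toℕ a <ᵇ v) ≡ v
count-below-toℕ {zero}  zero    z≤n       = refl
count-below-toℕ {suc n} zero    z≤n       = count-below-toℕ {n} zero z≤n
count-below-toℕ {suc n} (suc v) (s≤s v≤n) = cong suc (count-below-toℕ v v≤n)

count-above-toℕ : ∀ v → v < n → count {n} (λ a → v <ᵇ toℕ a) + suc v ≡ n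
count-above-toℕ {suc n} zero    _         = trans (+-comm (∑[ a < n ] 1) 1) (cong suc (∑-1 n))
count-above-toℕ {suc n} (suc v) (s≤s v<n) = trans (+-suc _ (suc v)) (cong suc (count-above-toℕ v v<n))

count-below : (σ : Permutation′ n) → ∀ v → v ≤ n → count (λ a → rank σ a <ᵇ v) ≡ v
count-below σ v v≤n = trans (sum-rank σ (λ x → if x <ᵇ v then 1 else 0)) (count-below-toℕ v v≤n)

count-above : (σ : Permutation′ n) → ∀ v → v < n → count (λ a → v <ᵇ rank σ a) + suc v ≡ n
count-above σ v v<n = trans (cong (_+ suc v) (sum-rank σ (λ x → if v <ᵇ x then 1 else 0))) (count-above-toℕ v v<n)

∑↑-upper-rank : (τ : Permutation′ n) (f : Fin n → ℕ) → ∑↑ (rank τ) (λ a b → f b) ≡ ∑[ b < n ] (rank τ b * f b)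
∑↑-upper-rank {n} τ f = trans (∑²-comm {n} _) (sum-cong-≗ (λ b →
  trans (sum-if (λ a → rank τ a <ᵇ rank τ b) (f b))
        (cong (_* f b) (count-below τ (rank τ b) (<⇒≤ (toℕ<n (τ ⟨$⟩ʳ b)))))))

∑↑-lower-rank : (τ : Permutation′ n) (f : Fin n → ℕ) →
                ∑↑ (rank τ) (λ a b → f a) + ∑[ a < n ] (suc (rank τ a) * f a) ≡ ∑[ a < n ] (n * f a)
∑↑-lower-rank {n} τ f = begin
  ∑↑ (rank τ) (λ a b → f a) + ∑[ a < n ] (suc (rank τ a) * f a)
    ≡⟨ cong (_+ ∑[ a < n ] (suc (rank τ a) * f a)) (sum-cong-≗ (λ a → sum-if (λ b → rank τ a <ᵇ rank τ b) (f a))) ⟩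
  ∑[ a < n ] (above a * f a) + ∑[ a < n ] (suc (rank τ a) * f a)
    ≡⟨ ∑-distrib-+ (λ a → above a * f a) (λ a → suc (rank τ a) * f a) ⟨
  ∑[ a < n ] (above a * f a + suc (rank τ a) * f a)
    ≡⟨ sum-cong-≗ (λ a → trans (sym (*-distribʳ-+ (f a) (above a) (suc (rank τ a))))
                               (cong (_* f a) (count-above τ (rank τ a) (toℕ<n (τ ⟨$⟩ʳ a))))) ⟩
  ∑[ a < n ] (n * f a)
    ∎
  where
  above : Fin n → ℕ
  above a = count (λ b → rank τ a <ᵇ rank τ b)

∑↑-upper-symmetric : (σ τ : Permutation′ n) → ∑↑ (rank τ) (λ a b → rank σ b) ≡ ∑↑ (rank σ) (λ a b → rank τ b)
∑↑-upper-symmetric {n} σ τ = begin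
  ∑↑ (rank τ) (λ a b → rank σ b)    ≡⟨ ∑↑-upper-rank τ (rank σ) ⟩
  ∑[ b < n ] (rank τ b * rank σ b)  ≡⟨ sum-cong-≗ (λ b → *-comm (rank τ b) (rank σ b)) ⟩
  ∑[ b < n ] (rank σ b * rank τ b)  ≡⟨ ∑↑-upper-rank σ (rank τ) ⟨
  ∑↑ (rank σ) (λ a b → rank τ b)    ∎

∑↑-lower-symmetric : (σ τ : Permutation′ n) → ∑↑ (rank τ) (λ a b → rank σ a) ≡ ∑↑ (rank σ) (λ a b → rank τ a)
∑↑-lower-symmetric {n} σ τ = +-cancelʳ-≡ _ _ _ (begin
  ∑↑ (rank τ) (λ a b → rank σ a) + ∑[ a < n ] (suc (rank τ a) * rank σ a) ≡⟨ ∑↑-lower-rank τ (rank σ) ⟩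
  ∑[ a < n ] (n * rank σ a)                                                ≡⟨ sum-rank σ (n *_) ⟩
  ∑[ a < n ] (n * toℕ a)                                                   ≡⟨ sum-rank τ (n *_) ⟨
  ∑[ a < n ] (n * rank τ a)                                                ≡⟨ ∑↑-lower-rank σ (rank τ) ⟨
  ∑↑ (rank σ) (λ a b → rank τ a) + ∑[ a < n ] (suc (rank σ a) * rank τ a) ≡⟨ cong (∑↑ (rank σ) (λ a b → rank τ a) +_) suc-rank-* ⟩
  ∑↑ (rank σ) (λ a b → rank τ a) + ∑[ a < n ] (suc (rank τ a) * rank σ a) ∎)
  where
  suc-rank-* : ∑[ a < n ] (suc (rank σ a) * rank τ a) ≡ ∑[ a < n ] (suc (rank τ a) * rank σ a)
  suc-rank-* = begin
    ∑[ a < n ] (rank τ a + rank σ a * rank τ a)             ≡⟨ ∑-distrib-+ (rank τ) (λ a → rank σ a * rank τ a) ⟩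
    ∑[ a < n ] rank τ a + ∑[ a < n ] (rank σ a * rank τ a)  ≡⟨ cong₂ _+_ (trans (sum-rank τ (λ x → x)) (sym (sum-rank σ (λ x → x))))
                                                                         (sum-cong-≗ (λ a → *-comm (rank σ a) (rank τ a))) ⟩
    ∑[ a < n ] rank σ a + ∑[ a < n ] (rank τ a * rank σ a)  ≡⟨ ∑-distrib-+ (rank σ) (λ a → rank τ a * rank σ a) ⟨
    ∑[ a < n ] (rank σ a + rank τ a * rank σ a)             ∎

-- Both sides, doubled, are the full double sum of φ over {0,…,n-1}².
∑↑-rank-symmetric : (σ τ : Permutation′ n) (φ : ℕ → ℕ → ℕ) → (∀ x y → φ x y ≡ φ y x) → (∀ x → φ x x ≡ 0) →
                    ∑↑ (rank τ) (λ a b → φ (rank σ a) (rank σ b)) ≡ ∑↑ (rank σ) (λ a b → φ (rank τ a) (rank τ b))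
∑↑-rank-symmetric {n} σ τ φ φ-sym φ-diag = m+m≡n+n⇒m≡n (begin
  ∑↑ (rank τ) (φ-along σ) + ∑↑ (rank τ) (φ-along σ) ≡⟨ ∑↑-double (rank τ) (φ-along σ) (along-sym σ) (along-tie τ σ) ⟩
  ∑² (φ-along σ)                                    ≡⟨ ∑²-rank σ φ ⟩
  ∑² {n} (λ a b → φ (toℕ a) (toℕ b))                ≡⟨ ∑²-rank τ φ ⟨
  ∑² (φ-along τ)                                    ≡⟨ ∑↑-double (rank σ) (φ-along τ) (along-sym τ) (along-tie σ τ) ⟨
  ∑↑ (rank σ) (φ-along τ) + ∑↑ (rank σ) (φ-along τ) ∎)
  where
  φ-along : Permutation′ n → Fin n → Fin n → ℕ
  φ-along ρ a b = φ (rank ρ a) (rank ρ b)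

  along-sym : ∀ ρ a b → φ-along ρ a b ≡ φ-along ρ b a
  along-sym ρ a b = φ-sym (rank ρ a) (rank ρ b)

  along-tie : ∀ ρ ρ′ a b → rank ρ a ≡ rank ρ b → φ-along ρ′ a b ≡ 0
  along-tie ρ ρ′ a b eq = trans (cong (λ c → φ (rank ρ′ a) (rank ρ′ c)) (sym (rank-injective ρ eq))) (φ-diag (rank ρ′ a))

rise-fall-symmetric : (σ τ : Permutation′ n) →
                      rise (rank τ) (rank σ) ≡ rise (rank σ) (rank τ) × fall (rank τ) (rank σ) ≡ fall (rank σ) (rank τ)
rise-fall-symmetric σ τ = +-cancel-crossed total difference
  where
  R F R′ F′ L U : ℕ
  R  = rise (rank τ) (rank σ)
  F  = fall (rank τ) (rank σ)
  R′ = rise (rank σ) (rank τ)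
  F′ = fall (rank σ) (rank τ)
  L  = ∑↑ (rank τ) (λ a b → rank σ a)
  U  = ∑↑ (rank τ) (λ a b → rank σ b)

  total : R + F ≡ R′ + F′
  total = begin
    R + F                                               ≡⟨ rise+fall (rank τ) (rank σ) ⟩
    ∑↑ (rank τ) (λ a b → ∣ rank σ a - rank σ b ∣)       ≡⟨ ∑↑-rank-symmetric σ τ ∣_-_∣ ∣-∣-comm ∣n-n∣≡0 ⟩
    ∑↑ (rank σ) (λ a b → ∣ rank τ a - rank τ b ∣)       ≡⟨ rise+fall (rank σ) (rank τ) ⟨
    R′ + F′                                             ∎

  balance′ : R′ + L ≡ F′ + U
  balance′ = begin
    R′ + L                                  ≡⟨ cong (R′ +_) (∑↑-lower-symmetric σ τ) ⟩
    R′ + ∑↑ (rank σ) (λ a b → rank τ a)     ≡⟨ rise-fall-balance (rank σ) (rank τ) ⟩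
    F′ + ∑↑ (rank σ) (λ a b → rank τ b)     ≡⟨ cong (F′ +_) (∑↑-upper-symmetric σ τ) ⟨
    F′ + U                                  ∎

  difference : R + F′ ≡ R′ + F
  difference = +-cancelʳ-≡ (L + U) _ _ (begin
    (R + F′) + (L + U)   ≡⟨ interchange R F′ L U ⟩
    (R + L) + (F′ + U)   ≡⟨ cong (_+ (F′ + U)) (rise-fall-balance (rank τ) (rank σ)) ⟩
    (F + U) + (F′ + U)   ≡⟨ +-comm (F + U) (F′ + U) ⟩
    (F′ + U) + (F + U)   ≡⟨ cong (_+ (F + U)) balance′ ⟨
    (R′ + L) + (F + U)   ≡⟨ interchange R′ L F U ⟩
    (R′ + F) + (L + U)   ∎)

ninvsum≡rise : (π : Permutation′ n) → ninvsum π ≡ rise (rank π) toℕ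
ninvsum≡rise {n} π = trans (pairSum≡∑² {n} _) (sym (rise≡∑↑-concordant (rank π) toℕ))

ninvValueSum≡rise : (π : Permutation′ n) → ninvValueSum π ≡ rise toℕ (rank π)
ninvValueSum≡rise {n} π = trans (pairSum≡∑² {n} _) (∑²-cong (λ a b →
  cong (λ w → if toℕ a <ᵇ toℕ b then w else 0) (if<ᵇ-∸ (rank π a) (rank π b))))

invsum≡fall : (π : Permutation′ n) → invsum π ≡ fall (rank π) toℕ
invsum≡fall {n} π = trans (pairSum≡∑² {n} _) (sym (fall≡∑↑-discordant (rank π) toℕ))

proposition2p4 : ∀ (n : ℕ) (π : Permutation′ n) →
    (ninvsum (flip π) ≡ ninvsum π)
    × (ninvValueSum π ≡ ninvsum π)
    × (invsum (flip π) ≡ invsum π)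
proposition2p4 n π =
    (begin
      ninvsum (flip π)          ≡⟨ ninvsum≡rise (flip π) ⟩
      rise (rank (flip π)) toℕ  ≡⟨ ∑↑-flip π _ ⟩
      rise toℕ (rank π)         ≡⟨ proj₁ symmetric ⟨
      rise (rank π) toℕ         ≡⟨ ninvsum≡rise π ⟨
      ninvsum π                 ∎)
  , trans (ninvValueSum≡rise π) (trans (sym (proj₁ symmetric)) (sym (ninvsum≡rise π)))
  , (begin
      invsum (flip π)           ≡⟨ invsum≡fall (flip π) ⟩
      fall (rank (flip π)) toℕ  ≡⟨ ∑↑-flip π _ ⟩
      fall toℕ (rank π)         ≡⟨ proj₂ symmetric ⟨
      fall (rank π) toℕ         ≡⟨ invsum≡fall π ⟨
      invsum π                  ∎)
  where
  symmetric : rise (rank π) toℕ ≡ rise toℕ (rank π) × fall (rank π) toℕ ≡ fall toℕ (rank π)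
  symmetric = rise-fall-symmetric id π
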